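{- For $m\ge 0$ let $A(m)=\left|\Pi_m^{eq}\wr C_2(\{1^a1^a,1^b1^b\})\right|$, where $a,b$ are the two colors of $C_2$ (so $A(0)=1$, counting the empty partition, and $A(1)=2$). Then for all $n\ge 2$, $$A(n)=2\bigl(A(n-1)+(n-1)A(n-2)\bigr).$$
   Context: $\Pi_n\wr C_2$ is the set of colored set partitions of $[n]$ with colors $a,b$ (a set partition of $[n]$ plus a color for each element). A colored partition eq-contains $1^\gamma1^\gamma$ if some block contains two elements both colored $\gamma$. $\Pi_n^{eq}\wr C_2(\{1^a1^a,1^b1^b\})$ is the set of colored partitions in which no block contains two elements of the same color. -}

module Defs where

open import Data.Nat using (ℕ; zero; suc; _≡ᵇ_; _≤ᵇ_)
open import Data.Bool using (Bool; true; false; _∧_; _∨_; not; if_then_else_)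
open import Data.List using (List; []; _∷_; map; concatMap; upTo; length; filterᵇ)
open import Data.Bool.ListAction using (any)
open import Data.Product using (_×_; _,_; proj₁; proj₂)

data Colour : Set where
  a b : Colour

_≟ᶜ_ : Colour → Colour → Bool
a ≟ᶜ a = true
b ≟ᶜ b = true
_ ≟ᶜ _ = false

allColours : List Colour
allColours = a ∷ b ∷ []

-- A coloured set partition of [n] = {1,…,n} is encoded canonically as a
-- list of length n whose i-th entry (block , colour) records the block of
-- element i and the colour of element i.  Blocks are labelled by a
-- restricted growth string: the first element is in block 0 and each
-- element lies either in an already opened block or opens the next block.
-- This gives a bijection between such lists and (set partition , colouring).

-- isRGS′ m xs : xs is a restricted growth string given that blocks
-- 0,…,m-1 are already opened.
isRGS′ : ℕ → List ℕ → Bool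
isRGS′ m []       = true
isRGS′ m (x ∷ xs) = (x ≤ᵇ m) ∧ isRGS′ (if x ≡ᵇ m then suc m else m) xs

isRGS : List ℕ → Bool
isRGS = isRGS′ 0

words : {A : Set} → List A → ℕ → List (List A)
words xs zero    = [] ∷ []
words xs (suc n) = concatMap (λ x → map (x ∷_) (words xs n)) xs

candidates : ℕ → List (List (ℕ × Colour))
candidates n = words (concatMap (λ k → map (k ,_) allColours) (upTo n)) n

colouredPartitions : ℕ → List (List (ℕ × Colour))
colouredPartitions n = filterᵇ (λ w → isRGS (map proj₁ w)) (candidates n)

-- Does the coloured partition eq-contain 1^γ1^γ for some colour γ, i.e.
-- does some block contain two (distinct) elements of the same colour?
sameBlockSameColour : ℕ × Colour → ℕ × Colour → Bool
sameBlockSameColour (i , c) (j , d) = (i ≡ᵇ j) ∧ (c ≟ᶜ d)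

containsMonochromePair : List (ℕ × Colour) → Bool
containsMonochromePair []       = false
containsMonochromePair (x ∷ xs) =
  any (sameBlockSameColour x) xs ∨ containsMonochromePair xs

avoiders : ℕ → List (List (ℕ × Colour))
avoiders n = filterᵇ (λ w → not (containsMonochromePair w)) (colouredPartitions n)

A : ℕ → ℕ
A n = length (avoiders n)

module Submission where

-- Proof idea (a transfer-matrix argument).  Read a coloured partition, in its
-- restricted-growth encoding, from left to right.  Among the blocks opened so
-- far, what matters is which of them still contain a single element (and of
-- which colour): a new element either opens a new block (2 colour choices) or
-- joins a singleton block, taking the colour that block is missing.  Blocks
-- holding one element of each colour can never grow again.  Hence the number
-- of ways to complete a prefix with h singleton blocks by n further elements
-- is  completions h n,  where
--   completions h (n + 1) = 2 · completions (h + 1) n + h · completions (h - 1) n.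

open import Defs
open import Data.Nat using (ℕ; _+_; _*_; _∸_; _≤_)
open import Relation.Binary.PropositionalEquality using (_≡_)

open import Data.Nat using (zero; suc; pred; _<_; _≡ᵇ_; _≤ᵇ_; s≤s)
open import Data.Nat.Properties
  using (+-identityʳ; +-assoc; +-comm; +-suc; *-zeroʳ; ≤-refl; ≤-reflexive; ≤-trans; +-monoˡ-≤; m≤m+n; n≤1+n)
open import Data.Nat.Tactic.RingSolver using (solve-∀)
open import Data.Bool using (Bool; true; false; _∧_; _∨_; not; if_then_else_)
open import Data.Bool.Properties using (∨-assoc; ∨-identityʳ; ∨-zeroʳ; ∧-zeroʳ; if-float)
open import Data.Bool.ListAction using (any)
open import Data.Maybe using (Maybe; just; nothing; maybe′; is-nothing)
import Data.Maybe as Maybe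
open import Data.List using (List; []; _∷_; map; concatMap; upTo; applyUpTo; length; filterᵇ; _++_)
open import Data.List.Properties using (map-++; map-cong)
open import Data.Nat.ListAction using (sum)
open import Data.Nat.ListAction.Properties using (sum-++)
open import Data.Product using (_×_; _,_; proj₁)
open import Relation.Binary.PropositionalEquality
  using (refl; sym; trans; cong; cong₂; module ≡-Reasoning)
open ≡-Reasoning

count : {X : Set} → (X → Bool) → List X → ℕ
count p xs = length (filterᵇ p xs)

count-cong : {X : Set} {p q : X → Bool} → (∀ x → p x ≡ q x) → ∀ xs → count p xs ≡ count q xs
count-cong {p = p} {q} e []       = refl
count-cong {p = p} {q} e (x ∷ xs) with p x | q x | e x
... | true  | .true  | refl = cong suc (count-cong e xs)
... | false | .false | refl = count-cong e xs

count-++ : {X : Set} (p : X → Bool) (xs ys : List X) → count p (xs ++ ys) ≡ count p xs + count p ys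
count-++ p []       ys = refl
count-++ p (x ∷ xs) ys with p x
... | true  = cong suc (count-++ p xs ys)
... | false = count-++ p xs ys

count-map : {X Y : Set} (p : Y → Bool) (f : X → Y) (xs : List X) →
  count p (map f xs) ≡ count (λ x → p (f x)) xs
count-map p f []       = refl
count-map p f (x ∷ xs) with p (f x)
... | true  = cong suc (count-map p f xs)
... | false = count-map p f xs

count-none : {X : Set} (xs : List X) → count (λ _ → false) xs ≡ 0
count-none []       = refl
count-none (x ∷ xs) = count-none xs

count-filter : {X : Set} (p q : X → Bool) (xs : List X) →
  count q (filterᵇ p xs) ≡ count (λ x → p x ∧ q x) xs
count-filter p q []       = refl
count-filter p q (x ∷ xs) with p x
... | false = count-filter p q xs
... | true with q x
...   | true  = cong suc (count-filter p q xs)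
...   | false = count-filter p q xs

count-words : {Y : Set} (p : List Y → Bool) (L : List Y) (n : ℕ) →
  count p (words L (suc n)) ≡ sum (map (λ x → count (λ w → p (x ∷ w)) (words L n)) L)
count-words {Y} p L n = count-concat L
  where
  W : List (List Y)
  W = words L n
  count-concat : ∀ M → count p (concatMap (λ y → map (y ∷_) W) M)
                       ≡ sum (map (λ y → count (λ w → p (y ∷ w)) W) M)
  count-concat []      = refl
  count-concat (y ∷ M) = trans (count-++ p (map (y ∷_) W) _)
                               (cong₂ _+_ (count-map p (y ∷_) W) (count-concat M))

-- Σ_{k<n} f k, defined by shifting the summand so that it matches the
-- recursion of  applyUpTo.
sumBelow : ℕ → (ℕ → ℕ) → ℕ
sumBelow zero    f = 0
sumBelow (suc n) f = f 0 + sumBelow n (λ k → f (suc k))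

sumBelow-cong : ∀ n {f g : ℕ → ℕ} → (∀ k → f k ≡ g k) → sumBelow n f ≡ sumBelow n g
sumBelow-cong zero    e = refl
sumBelow-cong (suc n) e = cong₂ _+_ (e 0) (sumBelow-cong n (λ k → e (suc k)))

sumBelow-zero : ∀ n → sumBelow n (λ _ → 0) ≡ 0
sumBelow-zero zero    = refl
sumBelow-zero (suc n) = sumBelow-zero n

sum-applyUpTo : (f u : ℕ → ℕ) (n : ℕ) → sum (map f (applyUpTo u n)) ≡ sumBelow n (λ k → f (u k))
sum-applyUpTo f u zero    = refl
sum-applyUpTo f u (suc n) = cong (f (u 0) +_) (sum-applyUpTo f (λ k → u (suc k)) n)

sum-concatMap : {X Y : Set} (f : Y → ℕ) (h : X → List Y) (L : List X) →
  sum (map f (concatMap h L)) ≡ sum (map (λ x → sum (map f (h x))) L)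
sum-concatMap f h []      = refl
sum-concatMap f h (x ∷ L) = begin
    sum (map f (h x ++ concatMap h L))
  ≡⟨ cong sum (map-++ f (h x) (concatMap h L)) ⟩
    sum (map f (h x) ++ map f (concatMap h L))
  ≡⟨ sum-++ (map f (h x)) _ ⟩
    sum (map f (h x)) + sum (map f (concatMap h L))
  ≡⟨ cong (sum (map f (h x)) +_) (sum-concatMap f h L) ⟩
    sum (map (λ y → sum (map f (h y))) (x ∷ L))
  ∎

-- The state of an opened block: it holds one element of the given colour,
-- or one element of each colour (then it is saturated).
data Block : Set where
  single    : Colour → Block
  saturated : Block

join : Block → Colour → Maybe Block
join (single a) b = just saturated
join (single b) a = just saturated
join _          _ = nothing

-- The state after a prefix: the opened blocks, in order of opening.
State : Set
State = List Block

isSingle : Block → ℕ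
isSingle (single _) = 1
isSingle saturated  = 0

singles : State → ℕ
singles []       = 0
singles (s ∷ st) = isSingle s + singles st

step : State → ℕ × Colour → Maybe State
step []       (zero  , c) = just (single c ∷ [])
step []       (suc k , c) = nothing
step (s ∷ st) (zero  , c) = Maybe.map (_∷ st) (join s c)
step (s ∷ st) (suc k , c) = Maybe.map (s ∷_) (step st (k , c))

accepts : State → List (ℕ × Colour) → Bool
accepts st []      = true
accepts st (x ∷ w) = maybe′ (λ st′ → accepts st′ w) false (step st x)

forbidden : State → ℕ × Colour → Bool
forbidden []       _           = false
forbidden (s ∷ st) (zero  , c) = is-nothing (join s c)
forbidden (s ∷ st) (suc k , c) = forbidden st (k , c)

avoids : (ℕ × Colour → Bool) → List (ℕ × Colour) → Bool
avoids F []      = true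
avoids F (x ∷ w) = not (F x) ∧ avoids (λ y → F y ∨ sameBlockSameColour x y) w

avoids-cong : {F G : ℕ × Colour → Bool} → (∀ y → F y ≡ G y) → ∀ w → avoids F w ≡ avoids G w
avoids-cong e []      = refl
avoids-cong e (x ∷ w) =
  cong₂ _∧_ (cong not (e x)) (avoids-cong (λ y → cong (_∨ sameBlockSameColour x y) (e y)) w)

any-∨ : {X : Set} (F G : X → Bool) (w : List X) → any (λ y → F y ∨ G y) w ≡ (any F w ∨ any G w)
any-∨ F G []      = refl
any-∨ F G (x ∷ w) with F x | G x
... | true  | _     = refl
... | false | true  = sym (∨-zeroʳ (any F w))
... | false | false = any-∨ F G w

not-∨-regroup : ∀ p q r s → (not p ∧ not ((q ∨ r) ∨ s)) ≡ not ((p ∨ q) ∨ (r ∨ s))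
not-∨-regroup true  q r s = refl
not-∨-regroup false q r s = cong not (∨-assoc q r s)

avoids-spec : (F : ℕ × Colour → Bool) (w : List (ℕ × Colour)) →
  avoids F w ≡ not (any F w ∨ containsMonochromePair w)
avoids-spec F []      = refl
avoids-spec F (x ∷ w) = begin
    not (F x) ∧ avoids (λ y → F y ∨ same y) w
  ≡⟨ cong (not (F x) ∧_) (avoids-spec (λ y → F y ∨ same y) w) ⟩
    not (F x) ∧ not (any (λ y → F y ∨ same y) w ∨ containsMonochromePair w)
  ≡⟨ cong (λ t → not (F x) ∧ not (t ∨ containsMonochromePair w)) (any-∨ F same w) ⟩
    not (F x) ∧ not ((any F w ∨ any same w) ∨ containsMonochromePair w)
  ≡⟨ not-∨-regroup (F x) (any F w) (any same w) (containsMonochromePair w) ⟩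
    not ((F x ∨ any F w) ∨ (any same w ∨ containsMonochromePair w))
  ∎
  where same = sameBlockSameColour x

any-false : {X : Set} (w : List X) → any (λ _ → false) w ≡ false
any-false []      = refl
any-false (x ∷ w) = any-false w

-- The number of opened blocks after appending a letter in block k to a prefix
-- with m opened blocks (the bookkeeping of  isRGS′).
nextOpened : ℕ → ℕ → ℕ
nextOpened m k = if k ≡ᵇ m then suc m else m

record Transition (st : State) (k : ℕ) (c : Colour) (st′ : State) : Set where
  field
    in-range       : (k ≤ᵇ length st) ≡ true
    allowed        : forbidden st (k , c) ≡ false
    opened         : length st′ ≡ nextOpened (length st) k
    forbidden-next : ∀ y → (forbidden st y ∨ sameBlockSameColour (k , c) y) ≡ forbidden st′ y

≤ᵇ-suc : ∀ k m → (suc k ≤ᵇ suc m) ≡ (k ≤ᵇ m)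
≤ᵇ-suc zero    m = refl
≤ᵇ-suc (suc k) m = refl

single-forbids : ∀ c d → (c ≟ᶜ d) ≡ is-nothing (join (single c) d)
single-forbids a a = refl
single-forbids a b = refl
single-forbids b a = refl
single-forbids b b = refl

join-forbids : ∀ s c s′ → join s c ≡ just s′ →
  ∀ d → (is-nothing (join s d) ∨ (c ≟ᶜ d)) ≡ is-nothing (join s′ d)
join-forbids (single a) b saturated refl a = refl
join-forbids (single a) b saturated refl b = refl
join-forbids (single b) a saturated refl a = refl
join-forbids (single b) a saturated refl b = refl
join-forbids (single a) a _ ()
join-forbids (single b) b _ ()
join-forbids saturated  _ _ ()

step-just : ∀ st k c {st′} → step st (k , c) ≡ just st′ → Transition st k c st′
step-just [] zero c refl = record
  { in-range = refl ; allowed = refl ; opened = refl ; forbidden-next = next }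
  where
  next : ∀ y → (false ∨ sameBlockSameColour (zero , c) y) ≡ forbidden (single c ∷ []) y
  next (zero  , d) = single-forbids c d
  next (suc j , d) = refl
step-just (s ∷ st) zero c eq with join s c in joined
step-just (s ∷ st) zero c refl | just s′ = record
  { in-range = refl ; allowed = cong is-nothing joined ; opened = refl ; forbidden-next = next }
  where
  next : ∀ y → (forbidden (s ∷ st) y ∨ sameBlockSameColour (zero , c) y) ≡ forbidden (s′ ∷ st) y
  next (zero  , d) = join-forbids s c s′ joined d
  next (suc j , d) = ∨-identityʳ (forbidden st (j , d))
step-just (s ∷ st) (suc k) c eq with step st (k , c) in stepped
step-just (s ∷ st) (suc k) c refl | just st″ = record
  { in-range = trans (≤ᵇ-suc k (length st)) in-range
  ; allowed = allowed
  ; opened = trans (cong suc opened) (if-float suc (k ≡ᵇ length st))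
  ; forbidden-next = next }
  where
  open Transition (step-just st k c stepped)
  next : ∀ y → (forbidden (s ∷ st) y ∨ sameBlockSameColour (suc k , c) y) ≡ forbidden (s ∷ st″) y
  next (zero  , d) = ∨-identityʳ (is-nothing (join s d))
  next (suc j , d) = forbidden-next (j , d)

step-nothing : ∀ st k c → step st (k , c) ≡ nothing →
  ((k ≤ᵇ length st) ∧ not (forbidden st (k , c))) ≡ false
step-nothing []       (suc k) c eq = refl
step-nothing (s ∷ st) zero    c eq with join s c
step-nothing (s ∷ st) zero    c eq | nothing = refl
step-nothing (s ∷ st) (suc k) c eq with step st (k , c) in stepped
step-nothing (s ∷ st) (suc k) c eq | nothing =
  trans (cong (_∧ not (forbidden st (k , c))) (≤ᵇ-suc k (length st))) (step-nothing st k c stepped)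

∧-interchange-false : ∀ p q r s → (p ∧ q) ≡ false → ((p ∧ r) ∧ (q ∧ s)) ≡ false
∧-interchange-false false q     r s eq = refl
∧-interchange-false true  false r s eq = ∧-zeroʳ r

accepts-correct : ∀ st w →
  accepts st w ≡ (isRGS′ (length st) (map proj₁ w) ∧ avoids (forbidden st) w)
accepts-correct st []            = refl
accepts-correct st ((k , c) ∷ w) with step st (k , c) in stepped
... | nothing = sym (∧-interchange-false (k ≤ᵇ length st) (not (forbidden st (k , c)))
                        (isRGS′ (nextOpened (length st) k) (map proj₁ w))
                        (avoids (λ y → forbidden st y ∨ sameBlockSameColour (k , c) y) w)
                        (step-nothing st k c stepped))
... | just st′ = begin
    accepts st′ w
  ≡⟨ accepts-correct st′ w ⟩
    isRGS′ (length st′) (map proj₁ w) ∧ avoids (forbidden st′) w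
  ≡⟨ cong₂ (λ m F → isRGS′ m (map proj₁ w) ∧ F) opened (avoids-cong (λ y → sym (forbidden-next y)) w) ⟩
    isRGS′ (nextOpened (length st) k) (map proj₁ w) ∧ avoids (λ y → forbidden st y ∨ sameBlockSameColour (k , c) y) w
  ≡⟨ sym (cong₂ (λ p q → (p ∧ isRGS′ (nextOpened (length st) k) (map proj₁ w))
                         ∧ (not q ∧ avoids (λ y → forbidden st y ∨ sameBlockSameColour (k , c) y) w))
                in-range allowed) ⟩
    isRGS′ (length st) (map proj₁ ((k , c) ∷ w)) ∧ avoids (forbidden st) ((k , c) ∷ w)
  ∎
  where open Transition (step-just st k c stepped)

accepts-empty : ∀ w → accepts [] w ≡ (isRGS (map proj₁ w) ∧ not (containsMonochromePair w))
accepts-empty w = begin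
    accepts [] w
  ≡⟨ accepts-correct [] w ⟩
    isRGS (map proj₁ w) ∧ avoids (λ _ → false) w
  ≡⟨ cong (isRGS (map proj₁ w) ∧_) (avoids-spec (λ _ → false) w) ⟩
    isRGS (map proj₁ w) ∧ not (any (λ _ → false) w ∨ containsMonochromePair w)
  ≡⟨ cong (λ t → isRGS (map proj₁ w) ∧ not (t ∨ containsMonochromePair w)) (any-false w) ⟩
    isRGS (map proj₁ w) ∧ not (containsMonochromePair w)
  ∎

-- completions h n: the number of ways to add n elements to a prefix with h
-- singleton blocks — open a new block in either colour, or complete one of
-- the h singleton blocks.
completions : ℕ → ℕ → ℕ
completions h zero    = 1
completions h (suc n) = 2 * completions (suc h) n + h * completions (pred h) n

-- The letters (block label < N , colour), in the order used by  candidates.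
letters : ℕ → List (ℕ × Colour)
letters N = concatMap (λ k → map (k ,_) allColours) (upTo N)

weight : (ℕ → ℕ) → State → ℕ × Colour → ℕ
weight G st x = maybe′ (λ st′ → G (singles st′)) 0 (step st x)

weight-cons : ∀ G s st k c →
  weight G (s ∷ st) (suc k , c) ≡ weight (λ h → G (isSingle s + h)) st (k , c)
weight-cons G s st k c with step st (k , c)
... | just st′ = refl
... | nothing  = refl

-- The weighted total over a block: a singleton block is completed in exactly
-- one way, and the shifted weights account for it in the singleton count.
cons-total : ∀ s h (G : ℕ → ℕ) →
  isSingle s * G h + (h * G (isSingle s + pred h) + 2 * G (isSingle s + suc h))
    ≡ (isSingle s + h) * G (pred (isSingle s + h)) + 2 * G (suc (isSingle s + h))
cons-total saturated h       G = refl
cons-total (single c) zero    G = refl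
cons-total (single c) (suc h) G =
  trans (cong (_+ (suc h * G (suc h) + 2 * G (3 + h))) (+-identityʳ (G (suc h))))
        (sym (+-assoc (G (suc h)) (suc h * G (suc h)) (2 * G (3 + h))))

-- Summing over all letters: from st there are 2 transitions opening a new
-- block (one more singleton) and one transition per singleton block (one
-- fewer singleton).
transitions-sum : ∀ st N (G : ℕ → ℕ) → length st < N →
  sumBelow N (λ k → weight G st (k , a) + (weight G st (k , b) + 0))
    ≡ singles st * G (pred (singles st)) + 2 * G (suc (singles st))
transitions-sum [] (suc N) G _ =
  trans (cong (2 * G 1 +_) (sumBelow-zero N)) (+-identityʳ (2 * G 1))
transitions-sum (s ∷ st) (suc N) G (s≤s st<N) = begin
    weight G (s ∷ st) (0 , a) + (weight G (s ∷ st) (0 , b) + 0)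
      + sumBelow N (λ k → weight G (s ∷ st) (suc k , a) + (weight G (s ∷ st) (suc k , b) + 0))
  ≡⟨ cong₂ _+_ (first-block s)
       (sumBelow-cong N (λ k → cong₂ (λ p q → p + (q + 0)) (weight-cons G s st k a) (weight-cons G s st k b))) ⟩
    isSingle s * G (singles st)
      + sumBelow N (λ k → weight G′ st (k , a) + (weight G′ st (k , b) + 0))
  ≡⟨ cong (isSingle s * G (singles st) +_) (transitions-sum st N G′ st<N) ⟩
    isSingle s * G (singles st) + (singles st * G′ (pred (singles st)) + 2 * G′ (suc (singles st)))
  ≡⟨ cons-total s (singles st) G ⟩
    singles (s ∷ st) * G (pred (singles (s ∷ st))) + 2 * G (suc (singles (s ∷ st)))
  ∎
  where
  G′ : ℕ → ℕ
  G′ h = G (isSingle s + h)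
  first-block : ∀ s → weight G (s ∷ st) (0 , a) + (weight G (s ∷ st) (0 , b) + 0) ≡ isSingle s * G (singles st)
  first-block (single a) = refl
  first-block (single b) = refl
  first-block saturated  = refl

nextOpened-≤ : ∀ m k → nextOpened m k ≤ suc m
nextOpened-≤ m k with k ≡ᵇ m
... | true  = ≤-refl
... | false = n≤1+n m

-- The transfer lemma: words of length n over block labels < N accepted from
-- st are counted by  completions, provided the labels never run out.
completions-count : ∀ N n st → length st + n ≤ N →
  count (accepts st) (words (letters N) n) ≡ completions (singles st) n
completions-count N zero    st _     = refl
completions-count N (suc n) st fits = begin
    count (accepts st) (words (letters N) (suc n))
  ≡⟨ count-words (accepts st) (letters N) n ⟩
    sum (map (λ x → count (λ w → accepts st (x ∷ w)) (words (letters N) n)) (letters N))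
  ≡⟨ cong sum (map-cong by-letter (letters N)) ⟩
    sum (map (weight G st) (letters N))
  ≡⟨ sum-concatMap (weight G st) (λ k → map (k ,_) allColours) (upTo N) ⟩
    sum (map (λ k → weight G st (k , a) + (weight G st (k , b) + 0)) (upTo N))
  ≡⟨ sum-applyUpTo (λ k → weight G st (k , a) + (weight G st (k , b) + 0)) (λ k → k) N ⟩
    sumBelow N (λ k → weight G st (k , a) + (weight G st (k , b) + 0))
  ≡⟨ transitions-sum st N G st<N ⟩
    singles st * G (pred (singles st)) + 2 * G (suc (singles st))
  ≡⟨ +-comm (singles st * G (pred (singles st))) _ ⟩
    completions (singles st) (suc n)
  ∎
  where
  G : ℕ → ℕ
  G h = completions h n
  room : suc (length st + n) ≤ N
  room = ≤-trans (≤-reflexive (sym (+-suc (length st) n))) fits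
  st<N : length st < N
  st<N = ≤-trans (s≤s (m≤m+n (length st) n)) room
  by-letter : ∀ x → count (λ w → accepts st (x ∷ w)) (words (letters N) n) ≡ weight G st x
  by-letter (k , c) with step st (k , c) in stepped
  ... | nothing  = count-none (words (letters N) n)
  ... | just st′ = completions-count N n st′ (≤-trans (+-monoˡ-≤ n st′-opened) room)
    where
    st′-opened : length st′ ≤ suc (length st)
    st′-opened = ≤-trans (≤-reflexive (Transition.opened (step-just st k c stepped))) (nextOpened-≤ (length st) k)

A-completions : ∀ n → A n ≡ completions 0 n
A-completions n = begin
    count (λ w → not (containsMonochromePair w)) (filterᵇ (λ w → isRGS (map proj₁ w)) (candidates n))
  ≡⟨ count-filter (λ w → isRGS (map proj₁ w)) (λ w → not (containsMonochromePair w)) (candidates n) ⟩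
    count (λ w → isRGS (map proj₁ w) ∧ not (containsMonochromePair w)) (candidates n)
  ≡⟨ count-cong (λ w → sym (accepts-empty w)) (candidates n) ⟩
    count (accepts []) (words (letters n) n)
  ≡⟨ completions-count n n [] ≤-refl ⟩
    completions 0 n
  ∎

-- The ring identity behind the inductive step of  completions-shift, with
-- X = c(h+1,n+1), Y = c(h+1,n), Z = c(h,n+1), W = c(h-1,n+1), V = c(h-1,n).
shift-arithmetic : ∀ X Y Z W V h n →
  2 * (X + suc n * Y) + (Z + (h * W + suc n * (h * V)))
    ≡ (2 * X + h * W) + (Z + suc n * (2 * Y + h * V))
shift-arithmetic = solve-∀

-- Adding a singleton block: a completion from h + 1 singletons either never
-- completes the extra block (c(h, n+1) ways) or completes it with one of the
-- n + 1 new elements (c(h, n) ways for the rest).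
completions-shift : ∀ n h →
  completions (suc h) (suc n) ≡ completions h (suc n) + suc n * completions h n
completions-shift zero    h = one-element h
  where
  one-element : ∀ h → 2 * 1 + suc h * 1 ≡ (2 * 1 + h * 1) + 1 * 1
  one-element = solve-∀
completions-shift (suc n) h = begin
    2 * c (2 + h) (suc n) + (c h (suc n) + h * c h (suc n))
  ≡⟨ cong₂ (λ p q → 2 * p + (c h (suc n) + q)) (completions-shift n (suc h)) (weighted h) ⟩
    2 * (c (suc h) (suc n) + suc n * c (suc h) n)
      + (c h (suc n) + (h * c (pred h) (suc n) + suc n * (h * c (pred h) n)))
  ≡⟨ shift-arithmetic (c (suc h) (suc n)) (c (suc h) n) (c h (suc n)) (c (pred h) (suc n)) (c (pred h) n) h n ⟩
    c h (suc (suc n)) + suc (suc n) * c h (suc n)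
  ∎
  where
  c : ℕ → ℕ → ℕ
  c = completions
  -- The induction hypothesis at h - 1, scaled by h (trivial when h = 0).
  weighted : ∀ h → h * c h (suc n) ≡ h * c (pred h) (suc n) + suc n * (h * c (pred h) n)
  weighted zero     = sym (*-zeroʳ n)
  weighted (suc h′) = begin
      suc h′ * c (suc h′) (suc n)
    ≡⟨ cong (suc h′ *_) (completions-shift n h′) ⟩
      suc h′ * (c h′ (suc n) + suc n * c h′ n)
    ≡⟨ scale-sum (suc h′) (c h′ (suc n)) (suc n) (c h′ n) ⟩
      suc h′ * c h′ (suc n) + suc n * (suc h′ * c h′ n)
    ∎
    where
    scale-sum : ∀ h x m y → h * (x + m * y) ≡ h * x + m * (h * y)
    scale-sum = solve-∀

theorem3p5 : (n : ℕ) → 2 ≤ n → A n ≡ 2 * (A (n ∸ 1) + (n ∸ 1) * A (n ∸ 2))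
theorem3p5 (suc (suc n)) (s≤s (s≤s _)) = begin
    A (suc (suc n))
  ≡⟨ A-completions (suc (suc n)) ⟩
    2 * completions 1 (suc n) + 0
  ≡⟨ +-identityʳ (2 * completions 1 (suc n)) ⟩
    2 * completions 1 (suc n)
  ≡⟨ cong (2 *_) (completions-shift n 0) ⟩
    2 * (completions 0 (suc n) + suc n * completions 0 n)
  ≡⟨ sym (cong₂ (λ p q → 2 * (p + suc n * q)) (A-completions (suc n)) (A-completions n)) ⟩
    2 * (A (suc n) + suc n * A n)
  ∎
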